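{- Let $K$ be a positive integer and $d,e$ integers. Then, with either choice of sign taken consistently (upper signs together, lower signs together), \[ f_{1,2K+1,1}(q^{d},q^{e},q)\pm q^{\frac{K+d+e}{2}}f_{1,2K+1,1}(q^{1+K+d},q^{1+K+e},q) =f_{K+1,K+1,1}\big(\mp q^{(K+d+e)/2},q^{d},q\big)\mp q^{(K+2-d-e)/2}f_{K+1,K+1,1}\big(\mp q^{2+(3K-d-e)/2},q^{K+2-e},q\big). \]
   Context: Let $q=e^{2\pi i\tau}$ with $\operatorname{Im}\tau>0$, and for real $\alpha$ write $q^{\alpha}:=e^{2\pi i \tau\alpha}$. For $x,y\in\mathbb{C}^*$ and positive integers $a,b,c$ define the Hecke-type double sum \[ f_{a,b,c}(x,y,q):=\Big(\sum_{r,s\ge0}-\sum_{r,s<0}\Big)(-1)^{r+s}x^ry^sq^{a\binom{r}{2}+brs+c\binom{s}{2}}. \] -}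

module Defs where

open import Data.Nat as ℕ using (ℕ; zero; suc)
open import Data.Integer as ℤ using (ℤ; +_; -_; _+_; _-_; _*_; ∣_∣; _◃_; 0ℤ; 1ℤ)
open import Data.Sign as Sign using (Sign)
open import Data.Bool using (Bool; true; false; if_then_else_; _∧_)
open import Data.List using (List; map; upTo; foldr; concatMap)
open import Relation.Nullary.Decidable using (⌊_⌋)

-- All series are Laurent series in q^{1/2};
-- exponents are recorded in HALF-units (an integer N stands for q^{N/2}).
-- An argument x = σ q^{u/2} (σ a sign, u ∈ ℤ) is encoded by the pair (σ , u).

sgnPow : Sign → ℕ → Sign
sgnPow σ zero    = Sign.+
sgnPow σ (suc n) = σ Sign.* sgnPow σ n

sumℤ : List ℤ → ℤ
sumℤ = foldr _+_ 0ℤ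

box : ℕ → List ℤ
box M = map (λ i → + i - + M) (upTo (suc (M ℕ.+ M)))

-- twice the exponent of q in x^r y^s q^{a C(r,2) + b r s + c C(s,2)}
-- for x = ±q^{u/2}, y = ±q^{v/2}
halfExp : ℕ → ℕ → ℕ → ℤ → ℤ → ℤ → ℤ → ℤ
halfExp a b c u v r s =
  + a * r * (r - 1ℤ) + + (2 ℕ.* b) * r * s + + c * s * (s - 1ℤ) + u * r + v * s

-- contribution of (r,s) to the coefficient of q^{N/2} in f_{a,b,c}(x,y,q)
term : ℕ → ℕ → ℕ → Sign → ℤ → Sign → ℤ → ℤ → ℤ → ℤ → ℤ
term a b c σx u σy v N r s =
  if ⌊ halfExp a b c u v r s ℤ.≟ N ⌋
  then (if ⌊ 0ℤ ℤ.≤? r ⌋ ∧ ⌊ 0ℤ ℤ.≤? s ⌋ then sg ◃ 1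
        else if ⌊ r ℤ.<? 0ℤ ⌋ ∧ ⌊ s ℤ.<? 0ℤ ⌋ then - (sg ◃ 1)
        else 0ℤ)
  else 0ℤ
  where
  sg : Sign
  sg = sgnPow Sign.- (∣ r ∣ ℕ.+ ∣ s ∣) Sign.* (sgnPow σx ∣ r ∣ Sign.* sgnPow σy ∣ s ∣)

-- coefficient of q^{N/2} in f_{a,b,c}(σx q^{u/2}, σy q^{v/2}, q),
-- truncated to the box -M ≤ r, s ≤ M
fCoeff : ℕ → ℕ → ℕ → Sign → ℤ → Sign → ℤ → ℕ → ℤ → ℤ
fCoeff a b c σx u σy v M N =
  sumℤ (concatMap (λ r → map (λ s → term a b c σx u σy v N r s) (box M)) (box M))

sgnℤ : Sign → ℤ
sgnℤ σ = σ ◃ 1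

-- truncated coefficient of q^{N/2} in the left-hand side
--   f_{1,2K+1,1}(q^d,q^e,q) ± q^{(K+d+e)/2} f_{1,2K+1,1}(q^{1+K+d},q^{1+K+e},q)
lhsCoeff : ℕ → ℤ → ℤ → Sign → ℕ → ℤ → ℤ
lhsCoeff K d e ε M N =
  fCoeff 1 (suc (2 ℕ.* K)) 1 Sign.+ (+ 2 * d) Sign.+ (+ 2 * e) M N
  + sgnℤ ε * fCoeff 1 (suc (2 ℕ.* K)) 1
                Sign.+ (+ 2 * (1ℤ + + K + d)) Sign.+ (+ 2 * (1ℤ + + K + e))
                M (N - (+ K + d + e))

-- truncated coefficient of q^{N/2} in the right-hand side
--   f_{K+1,K+1,1}(∓q^{(K+d+e)/2},q^d,q) ∓ q^{(K+2-d-e)/2} f_{K+1,K+1,1}(∓q^{2+(3K-d-e)/2},q^{K+2-e},q)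
rhsCoeff : ℕ → ℤ → ℤ → Sign → ℕ → ℤ → ℤ
rhsCoeff K d e ε M N =
  fCoeff (suc K) (suc K) 1 (Sign.opposite ε) (+ K + d + e) Sign.+ (+ 2 * d) M N
  - sgnℤ ε * fCoeff (suc K) (suc K) 1
                (Sign.opposite ε) (+ 4 + + (3 ℕ.* K) - d - e) Sign.+ (+ 2 * (+ K + + 2 - e))
                M (N - (+ K + + 2 - d - e))

{-# OPTIONS --safe #-}

-- Only summands
-- with r, s ≥ 0 or r, s < 0 occur, so r s ≥ 0, and then the exponent is at least
-- r² + s² minus a linear form in ∣r∣, ∣s∣: each coefficient is a finite sum, and
-- all sufficiently large box truncations of it agree.
-- In the second right-hand series substitute m ↦ - m - 2n - 1.  Its exponents then
-- match those of the first right-hand series, and for m = 2s or m = 2s + 1 the two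
-- quadrant conditions on (m, n) combine into the quadrant condition on (n + s, s).
-- So, split by the parity of m, the combined right-hand summand is the summand of
-- the first, respectively ± that of the second, left-hand series at (n + s, s).

module Submission where

open import Defs

open import Data.Bool using (true; false; if_then_else_; _∧_)
open import Data.Empty using (⊥; ⊥-elim)
open import Data.Integer as ℤ using (ℤ; +_; -[1+_]; -_; _+_; _-_; _*_; ∣_∣; 0ℤ; 1ℤ; -1ℤ; +≤+)
import Data.Integer.Properties as ℤP
open import Data.Integer.Tactic.RingSolver using (solve-∀)
open import Data.List using (List; []; _∷_; _++_; map; upTo; applyUpTo; concatMap)
import Data.List.Properties as ListP
open import Data.Nat as ℕ using (ℕ; zero; suc; z≤n; s≤s; _≤_; _<_)
import Data.Nat.Properties as ℕP
import Data.Nat.Tactic.RingSolver as ℕ-Solver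
open import Data.Product using (_×_; _,_; ∃-syntax)
open import Data.Sign as Sign using (Sign)
import Data.Sign.Properties as SignP
open import Data.Sum using (_⊎_; inj₁; inj₂)
open import Function using (_∘_)
open import Relation.Binary.PropositionalEquality
open import Relation.Nullary using (Dec; yes; no; ¬_)
open import Relation.Nullary.Decidable using (⌊_⌋; isYes≗does; dec-true; dec-false)
open import Algebra.Properties.CommutativeSemigroup ℤP.+-commutativeSemigroup
  using () renaming (interchange to +-interchange)
open import Algebra.Properties.CommutativeSemigroup SignP.*-commutativeSemigroup
  using () renaming (interchange to *-interchange)

-- Finite sums

∑ : ℕ → (ℕ → ℤ) → ℤ
∑ zero    f = 0ℤ
∑ (suc n) f = f 0 + ∑ n (f ∘ suc)

∑-cong-< : ∀ n {f g : ℕ → ℤ} → (∀ k → k < n → f k ≡ g k) → ∑ n f ≡ ∑ n g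
∑-cong-< zero    eq = refl
∑-cong-< (suc n) eq = cong₂ _+_ (eq 0 (s≤s z≤n)) (∑-cong-< n (λ k k<n → eq (suc k) (s≤s k<n)))

∑-cong : ∀ n {f g : ℕ → ℤ} → (∀ k → f k ≡ g k) → ∑ n f ≡ ∑ n g
∑-cong n eq = ∑-cong-< n (λ k _ → eq k)

∑-vanishing : ∀ n {f : ℕ → ℤ} → (∀ k → k < n → f k ≡ 0ℤ) → ∑ n f ≡ 0ℤ
∑-vanishing zero    eq = refl
∑-vanishing (suc n) eq =
  cong₂ _+_ (eq 0 (s≤s z≤n)) (∑-vanishing n (λ k k<n → eq (suc k) (s≤s k<n)))

∑-split : ∀ m n (f : ℕ → ℤ) → ∑ (m ℕ.+ n) f ≡ ∑ m f + ∑ n (λ k → f (m ℕ.+ k))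
∑-split zero    n f = sym (ℤP.+-identityˡ _)
∑-split (suc m) n f = trans (cong (_+_ (f 0)) (∑-split m n (f ∘ suc))) (sym (ℤP.+-assoc (f 0) _ _))

∑-distrib-+ : ∀ n (f g : ℕ → ℤ) → ∑ n (λ k → f k + g k) ≡ ∑ n f + ∑ n g
∑-distrib-+ zero    f g = refl
∑-distrib-+ (suc n) f g =
  trans (cong (_+_ (f 0 + g 0)) (∑-distrib-+ n (f ∘ suc) (g ∘ suc))) (+-interchange (f 0) (g 0) _ _)

*-distribˡ-∑ : ∀ n c (f : ℕ → ℤ) → c * ∑ n f ≡ ∑ n (λ k → c * f k)
*-distribˡ-∑ zero    c f = ℤP.*-zeroʳ c
*-distribˡ-∑ (suc n) c f = trans (ℤP.*-distribˡ-+ c (f 0) _) (cong (_+_ (c * f 0)) (*-distribˡ-∑ n c (f ∘ suc)))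

∑-comm : ∀ m n (g : ℕ → ℕ → ℤ) → ∑ m (λ i → ∑ n (g i)) ≡ ∑ n (λ j → ∑ m (λ i → g i j))
∑-comm zero    n g = sym (∑-vanishing n (λ _ _ → refl))
∑-comm (suc m) n g =
  trans (cong (_+_ (∑ n (g 0))) (∑-comm m n (g ∘ suc))) (sym (∑-distrib-+ n (g 0) _))

∑-reverse : ∀ n (f : ℕ → ℤ) → ∑ n f ≡ ∑ n (λ k → f (n ℕ.∸ suc k))
∑-reverse zero    f = refl
∑-reverse (suc n) f = trans (∑-last n f) (trans (cong (_+ f n) (∑-reverse n f)) (ℤP.+-comm _ (f n)))
  where
  ∑-last : ∀ n (f : ℕ → ℤ) → ∑ (suc n) f ≡ ∑ n f + f n
  ∑-last zero    f = trans (ℤP.+-identityʳ (f 0)) (sym (ℤP.+-identityˡ (f 0)))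
  ∑-last (suc n) f = trans (cong (_+_ (f 0)) (∑-last n (f ∘ suc))) (sym (ℤP.+-assoc (f 0) _ _))

∑-even-odd : ∀ n (f : ℕ → ℤ) →
  ∑ (n ℕ.+ n) f ≡ ∑ n (λ k → f (k ℕ.+ k)) + ∑ n (λ k → f (suc (k ℕ.+ k)))
∑-even-odd zero    f = refl
∑-even-odd (suc n) f = begin
    ∑ (suc n ℕ.+ suc n) f
  ≡⟨ cong (λ m → ∑ (suc m) f) (ℕP.+-suc n n) ⟩
    f 0 + (f 1 + ∑ (n ℕ.+ n) (f ∘ suc ∘ suc))
  ≡⟨ cong (λ z → f 0 + (f 1 + z)) (∑-even-odd n (f ∘ suc ∘ suc)) ⟩
    f 0 + (f 1 + (∑ n (λ k → f (suc (suc (k ℕ.+ k)))) + ∑ n (λ k → f (suc (suc (suc (k ℕ.+ k)))))))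
  ≡⟨ cong₂ (λ a b → f 0 + (f 1 + (a + b)))
       (∑-cong n (λ k → cong (f ∘ suc) (sym (ℕP.+-suc k k))))
       (∑-cong n (λ k → cong (f ∘ suc ∘ suc) (sym (ℕP.+-suc k k)))) ⟩
    f 0 + (f 1 + (∑ n (λ k → f (suc k ℕ.+ suc k)) + ∑ n (λ k → f (suc (suc k ℕ.+ suc k)))))
  ≡⟨ regroup (f 0) (f 1) _ _ ⟩
    ∑ (suc n) (λ k → f (k ℕ.+ k)) + ∑ (suc n) (λ k → f (suc (k ℕ.+ k))) ∎
  where
  open ≡-Reasoning
  regroup : ∀ a b c d → a + (b + (c + d)) ≡ a + c + (b + d)
  regroup = solve-∀

sumℤ-++ : ∀ (xs ys : List ℤ) → sumℤ (xs ++ ys) ≡ sumℤ xs + sumℤ ys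
sumℤ-++ []       ys = sym (ℤP.+-identityˡ _)
sumℤ-++ (x ∷ xs) ys = trans (cong (_+_ x) (sumℤ-++ xs ys)) (sym (ℤP.+-assoc x _ _))

sumℤ-concatMap : ∀ {A : Set} (f : A → List ℤ) (xs : List A) →
  sumℤ (concatMap f xs) ≡ sumℤ (map (sumℤ ∘ f) xs)
sumℤ-concatMap f []       = refl
sumℤ-concatMap f (x ∷ xs) = trans (sumℤ-++ (f x) _) (cong (_+_ (sumℤ (f x))) (sumℤ-concatMap f xs))

sumℤ-applyUpTo : ∀ n (f : ℕ → ℤ) → sumℤ (applyUpTo f n) ≡ ∑ n f
sumℤ-applyUpTo zero    f = refl
sumℤ-applyUpTo (suc n) f = cong (_+_ (f 0)) (sumℤ-applyUpTo n (f ∘ suc))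

∑box : ℕ → (ℤ → ℤ) → ℤ
∑box M h = ∑ (suc (M ℕ.+ M)) (λ k → h (+ k - + M))

∑box² : ℕ → (ℤ → ℤ → ℤ) → ℤ
∑box² M g = ∑box M (λ r → ∑box M (g r))

sumℤ-map-box : ∀ M (h : ℤ → ℤ) → sumℤ (map h (box M)) ≡ ∑box M h
sumℤ-map-box M h = begin
    sumℤ (map h (map shift (upTo L)))  ≡⟨ cong sumℤ (sym (ListP.map-∘ {g = h} {f = shift} (upTo L))) ⟩
    sumℤ (map (h ∘ shift) (upTo L))    ≡⟨ cong sumℤ (ListP.map-applyUpTo (λ k → k) (h ∘ shift) L) ⟩
    sumℤ (applyUpTo (h ∘ shift) L)     ≡⟨ sumℤ-applyUpTo L (h ∘ shift) ⟩
    ∑box M h                           ∎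
  where
  open ≡-Reasoning
  L : ℕ
  L = suc (M ℕ.+ M)
  shift : ℕ → ℤ
  shift i = + i - + M

fCoeff≡∑box² : ∀ a b c σx u σy v M N →
  fCoeff a b c σx u σy v M N ≡ ∑box² M (term a b c σx u σy v N)
fCoeff≡∑box² a b c σx u σy v M N =
  trans (sumℤ-concatMap (λ r → map (t r) (box M)) (box M))
  (trans (cong sumℤ (ListP.map-cong (λ r → sumℤ-map-box M (t r)) (box M)))
         (sumℤ-map-box M (λ r → ∑box M (t r))))
  where
  t : ℤ → ℤ → ℤ
  t = term a b c σx u σy v N

-- Box sums of finitely supported functions

SupportedIn : ℕ → (ℤ → ℤ) → Set
SupportedIn B h = ∀ i → B < ∣ i ∣ → h i ≡ 0ℤ

∑interval : ℤ → ℕ → (ℤ → ℤ) → ℤ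
∑interval a n h = ∑ n (λ k → h (a + + k))

0≤∣i∣-i : ∀ i → 0ℤ ℤ.≤ + ∣ i ∣ - i
0≤∣i∣-i (+ n)    = ℤP.≤-reflexive (sym (ℤP.+-inverseʳ (+ n)))
0≤∣i∣-i -[1+ n ] = +≤+ z≤n

0≤∣i∣+i : ∀ i → 0ℤ ℤ.≤ + ∣ i ∣ + i
0≤∣i∣+i (+ n)    = +≤+ z≤n
0≤∣i∣+i -[1+ n ] = ℤP.≤-reflexive (sym (ℤP.+-inverseʳ (+ suc n)))

∑interval-padded : ∀ {h} B → SupportedIn B h → ∀ p q →
  ∑interval (- + B - + p) (p ℕ.+ suc (B ℕ.+ B) ℕ.+ q) h ≡ ∑box B h
∑interval-padded {h} B supp p q = begin
    ∑ (p ℕ.+ L ℕ.+ q) (λ k → h (a + + k))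
  ≡⟨ ∑-split (p ℕ.+ L) q _ ⟩
    ∑ (p ℕ.+ L) (λ k → h (a + + k)) + ∑ q (λ k → h (a + + (p ℕ.+ L ℕ.+ k)))
  ≡⟨ cong₂ _+_ (∑-split p L _) (∑-vanishing q right) ⟩
    ∑ p (λ k → h (a + + k)) + ∑ L (λ k → h (a + + (p ℕ.+ k))) + 0ℤ
  ≡⟨ ℤP.+-identityʳ _ ⟩
    ∑ p (λ k → h (a + + k)) + ∑ L (λ k → h (a + + (p ℕ.+ k)))
  ≡⟨ cong₂ _+_ (∑-vanishing p left) (∑-cong L middle) ⟩
    0ℤ + ∑box B h
  ≡⟨ ℤP.+-identityˡ _ ⟩
    ∑box B h ∎
  where
  open ≡-Reasoning
  a : ℤ
  a = - + B - + p
  L : ℕ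
  L = suc (B ℕ.+ B)
  left : ∀ k → k < p → h (a + + k) ≡ 0ℤ
  left k k<p = supp _ (subst (λ z → B < ∣ z ∣) (sym a+k≡) B<∣a+k∣)
    where
    j : ℕ
    j = p ℕ.∸ k
    a+k≡ : a + + k ≡ - (+ B + + j)
    a+k≡ = trans (cong (λ z → - + B - z + + k) (cong +_ (sym (ℕP.m∸n+n≡m (ℕP.<⇒≤ k<p)))))
                 (ring (+ B) (+ j) (+ k))
      where
      ring : ∀ b j k → - b - (j + k) + k ≡ - (b + j)
      ring = solve-∀
    B<∣a+k∣ : B < ∣ - (+ B + + j) ∣
    B<∣a+k∣ = subst (B <_) (sym (ℤP.∣-i∣≡∣i∣ (+ (B ℕ.+ j)))) (ℕP.m<m+n B (ℕP.m<n⇒0<n∸m k<p))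
  middle : ∀ k → h (a + + (p ℕ.+ k)) ≡ h (+ k - + B)
  middle k = cong h (ring (+ B) (+ p) (+ k))
    where
    ring : ∀ b p k → - b - p + (p + k) ≡ k - b
    ring = solve-∀
  right : ∀ k → k < q → h (a + + (p ℕ.+ L ℕ.+ k)) ≡ 0ℤ
  right k _ = supp _ (subst (λ z → B < ∣ z ∣) (sym (ring (+ B) (+ p) (+ k))) (s≤s (ℕP.m≤m+n B k)))
    where
    ring : ∀ b p k → - b - p + (p + (1ℤ + b + b) + k) ≡ 1ℤ + b + k
    ring = solve-∀

∑interval≡∑box : ∀ {h} B → SupportedIn B h → ∀ a n →
  0ℤ ℤ.≤ - + B - a → 0ℤ ℤ.≤ a + + n - + B - 1ℤ → ∑interval a n h ≡ ∑box B h
∑interval≡∑box {h} B supp a n below above =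
  trans (cong₂ (λ x y → ∑interval x y h) a≡ n≡) (∑interval-padded B supp p q)
  where
  p : ℕ
  p = ∣ - + B - a ∣
  q : ℕ
  q = ∣ a + + n - + B - 1ℤ ∣
  p≡ : + p ≡ - + B - a
  p≡ = ℤP.0≤i⇒+∣i∣≡i below
  q≡ : + q ≡ a + + n - + B - 1ℤ
  q≡ = ℤP.0≤i⇒+∣i∣≡i above
  ring₁ : ∀ b a → a ≡ - b - (- b - a)
  ring₁ = solve-∀
  ring₂ : ∀ b a n → n ≡ (- b - a) + (1ℤ + b + b) + (a + n - b - 1ℤ)
  ring₂ = solve-∀
  a≡ : a ≡ - + B - + p
  a≡ = trans (ring₁ (+ B) a) (cong (λ z → - + B - z) (sym p≡))
  n≡ : n ≡ p ℕ.+ suc (B ℕ.+ B) ℕ.+ q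
  n≡ = ℤP.+-injective (trans (ring₂ (+ B) a (+ n))
         (cong₂ (λ x y → x + (1ℤ + + B + + B) + y) (sym p≡) (sym q≡)))

∑box-shift : ∀ {h} B M c → SupportedIn B h → ∣ c ∣ ℕ.+ B ≤ M →
  ∑box M (λ i → h (i + c)) ≡ ∑box B h
∑box-shift {h} B M c supp le =
  trans (∑-cong (suc (M ℕ.+ M)) (λ k → cong h (ring₀ (+ k) (+ M) c)))
        (∑interval≡∑box B supp (- + M + c) (suc (M ℕ.+ M))
          (subst (0ℤ ℤ.≤_) (ring₁ (+ B) (+ M) (+ ∣ c ∣) c) (ℤP.+-mono-≤ gap (0≤∣i∣-i c)))
          (subst (0ℤ ℤ.≤_) (ring₂ (+ B) (+ M) (+ ∣ c ∣) c) (ℤP.+-mono-≤ gap (0≤∣i∣+i c))))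
  where
  gap : 0ℤ ℤ.≤ + M - (+ ∣ c ∣ + + B)
  gap = ℤP.i≤j⇒0≤j-i (+≤+ le)
  ring₀ : ∀ k m c → k - m + c ≡ - m + c + k
  ring₀ = solve-∀
  ring₁ : ∀ b m a c → m - (a + b) + (a - c) ≡ - b - (- m + c)
  ring₁ = solve-∀
  ring₂ : ∀ b m a c → m - (a + b) + (a + c) ≡ - m + c + (1ℤ + m + m) - b - 1ℤ
  ring₂ = solve-∀

∑box-resize : ∀ {h} B M → SupportedIn B h → B ≤ M → ∑box M h ≡ ∑box B h
∑box-resize {h} B M supp le =
  trans (∑-cong (suc (M ℕ.+ M)) (λ k → cong h (sym (ℤP.+-identityʳ (+ k - + M))))) (∑box-shift B M 0ℤ supp le)

∑box-neg : ∀ M h → ∑box M (h ∘ -_) ≡ ∑box M h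
∑box-neg M h = trans (∑-reverse (suc (M ℕ.+ M)) (λ k → h (- (+ k - + M))))
                     (∑-cong-< (suc (M ℕ.+ M)) (λ k k< → cong h (reflect k (ℕP.≤-pred k<))))
  where
  ring : ∀ m k → - ((m + m - k) - m) ≡ k - m
  ring = solve-∀
  reflect : ∀ k → k ≤ M ℕ.+ M → - (+ (M ℕ.+ M ℕ.∸ k) - + M) ≡ + k - + M
  reflect k le = trans (cong (λ z → - (z - + M)) (sym (trans (ℤP.m-n≡m⊖n (M ℕ.+ M) k) (ℤP.⊖-≥ le))))
                       (ring (+ M) (+ k))

∑box-even-odd : ∀ {h} B Q → SupportedIn B h → B ≤ Q ℕ.+ Q →
  ∑box (Q ℕ.+ Q) h ≡ ∑box Q (λ s → h (+ 2 * s)) + ∑box Q (λ s → h (+ 2 * s + 1ℤ))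
∑box-even-odd {h} B Q supp le = begin
    ∑box (Q ℕ.+ Q) h
  ≡⟨ ∑box-resize B (Q ℕ.+ Q) supp le ⟩
    ∑box B h
  ≡⟨ ∑interval≡∑box B supp a (L ℕ.+ L)
       (subst (0ℤ ℤ.≤_) (ring₁ (+ B) (+ Q)) gap)
       (subst (0ℤ ℤ.≤_) (ring₂ (+ B) (+ Q)) (ℤP.+-mono-≤ gap (+≤+ z≤n))) ⟨
    ∑ (L ℕ.+ L) (λ k → h (a + + k))
  ≡⟨ ∑-even-odd L (λ k → h (a + + k)) ⟩
    ∑ L (λ k → h (a + + (k ℕ.+ k))) + ∑ L (λ k → h (a + + suc (k ℕ.+ k)))
  ≡⟨ cong₂ _+_ (∑-cong L (λ k → cong h (ring₃ (+ Q) (+ k))))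
               (∑-cong L (λ k → cong h (ring₄ (+ Q) (+ k)))) ⟩
    ∑box Q (λ s → h (+ 2 * s)) + ∑box Q (λ s → h (+ 2 * s + 1ℤ)) ∎
  where
  open ≡-Reasoning
  L : ℕ
  L = suc (Q ℕ.+ Q)
  a : ℤ
  a = - + (Q ℕ.+ Q)
  gap : 0ℤ ℤ.≤ + (Q ℕ.+ Q) - + B
  gap = ℤP.i≤j⇒0≤j-i (+≤+ le)
  ring₁ : ∀ b q → (q + q) - b ≡ - b - - (q + q)
  ring₁ = solve-∀
  ring₂ : ∀ b q → (q + q) - b + 1ℤ ≡ - (q + q) + ((1ℤ + q + q) + (1ℤ + q + q)) - b - 1ℤ
  ring₂ = solve-∀
  ring₃ : ∀ q k → - (q + q) + (k + k) ≡ + 2 * (k - q)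
  ring₃ = solve-∀
  ring₄ : ∀ q k → - (q + q) + (1ℤ + (k + k)) ≡ + 2 * (k - q) + 1ℤ
  ring₄ = solve-∀

SupportedIn² : ℕ → (ℤ → ℤ → ℤ) → Set
SupportedIn² B g = ∀ r s → B < ∣ r ∣ ⊎ B < ∣ s ∣ → g r s ≡ 0ℤ

∑box-cong : ∀ M {h h′ : ℤ → ℤ} → (∀ i → h i ≡ h′ i) → ∑box M h ≡ ∑box M h′
∑box-cong M eq = ∑-cong (suc (M ℕ.+ M)) (λ k → eq (+ k - + M))

∑box-vanishing : ∀ M {h : ℤ → ℤ} → (∀ i → h i ≡ 0ℤ) → ∑box M h ≡ 0ℤ
∑box-vanishing M eq = ∑-vanishing (suc (M ℕ.+ M)) (λ k _ → eq (+ k - + M))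

∑box²-resize : ∀ {g} B M → SupportedIn² B g → B ≤ M → ∑box² M g ≡ ∑box² B g
∑box²-resize {g} B M supp le =
  trans (∑box-cong M (λ r → ∑box-resize B M (λ s B<s → supp r s (inj₂ B<s)) le))
        (∑box-resize B M (λ r B<r → ∑box-vanishing B (λ s → supp r s (inj₁ B<r))) le)

∑box²-stable : ∀ {g} B W M → SupportedIn² B g → B ≤ W → W ≤ M → ∑box² M g ≡ ∑box² W g
∑box²-stable B W M supp B≤W W≤M =
  trans (∑box²-resize B M supp (ℕP.≤-trans B≤W W≤M)) (sym (∑box²-resize B W supp B≤W))

∑box²-comm : ∀ M g → ∑box² M (λ r s → g s r) ≡ ∑box² M g
∑box²-comm M g = ∑-comm (suc (M ℕ.+ M)) (suc (M ℕ.+ M)) (λ i j → g (+ j - + M) (+ i - + M))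

∑box²-distrib-+ : ∀ M f g → ∑box² M (λ r s → f r s + g r s) ≡ ∑box² M f + ∑box² M g
∑box²-distrib-+ M f g =
  trans (∑box-cong M (λ r → ∑-distrib-+ (suc (M ℕ.+ M)) (λ k → f r (+ k - + M)) (λ k → g r (+ k - + M))))
        (∑-distrib-+ (suc (M ℕ.+ M)) (λ k → ∑box M (f (+ k - + M))) (λ k → ∑box M (g (+ k - + M))))

*-distribˡ-∑box² : ∀ M c f → c * ∑box² M f ≡ ∑box² M (λ r s → c * f r s)
*-distribˡ-∑box² M c f =
  trans (*-distribˡ-∑ (suc (M ℕ.+ M)) c (λ k → ∑box M (f (+ k - + M))))
        (∑box-cong M (λ r → *-distribˡ-∑ (suc (M ℕ.+ M)) c (λ k → f r (+ k - + M))))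

∑box²-shear : ∀ {g} B M → SupportedIn² B g → B ℕ.+ B ≤ M →
  ∑box² M (λ s n → g (n + s) s) ≡ ∑box² M g
∑box²-shear {g} B M supp le = trans (∑box-cong M column) (∑box²-comm M g)
  where
  column : ∀ s → ∑box M (λ n → g (n + s) s) ≡ ∑box M (λ r → g r s)
  column s with ∣ s ∣ ℕ.≤? B
  ... | yes s≤B = trans (∑box-shift B M s (λ r B<r → supp r s (inj₁ B<r)) (ℕP.≤-trans (ℕP.+-monoˡ-≤ B s≤B) le))
                        (sym (∑box-resize B M (λ r B<r → supp r s (inj₁ B<r)) (ℕP.≤-trans (ℕP.m≤m+n B B) le)))
  ... | no s≰B  = trans (∑box-vanishing M (λ n → supp (n + s) s (inj₂ (ℕP.≰⇒> s≰B))))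
                        (sym (∑box-vanishing M (λ r → supp r s (inj₂ (ℕP.≰⇒> s≰B)))))

∑box-sheared-rows : ∀ {g} B Q M → SupportedIn² B g → B ≤ Q → Q ≤ M → B ℕ.+ B ≤ M →
  ∑box Q (λ s → ∑box M (λ n → g (n + s) s)) ≡ ∑box² M g
∑box-sheared-rows {g} B Q M supp B≤Q Q≤M 2B≤M =
  trans (trans (∑box-resize B Q rows-supported B≤Q) (sym (∑box-resize B M rows-supported (ℕP.≤-trans B≤Q Q≤M))))
        (∑box²-shear B M supp 2B≤M)
  where
  rows-supported : SupportedIn B (λ s → ∑box M (λ n → g (n + s) s))
  rows-supported s B<s = ∑box-vanishing M (λ n → supp (n + s) s (inj₂ B<s))

-- m ↦ - m + ψ n is the involution m ↦ - m - 2n - 1 of the substitution.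
ψ : ℤ → ℤ
ψ n = - (+ 2 * n) - 1ℤ

∣ψ∣≤ : ∀ n → ∣ ψ n ∣ ≤ suc (∣ n ∣ ℕ.+ ∣ n ∣)
∣ψ∣≤ n = begin
    ∣ - (+ 2 * n) - 1ℤ ∣          ≤⟨ ℤP.∣i-j∣≤∣i∣+∣j∣ (- (+ 2 * n)) 1ℤ ⟩
    ∣ - (+ 2 * n) ∣ ℕ.+ 1          ≡⟨ cong (ℕ._+ 1) (trans (ℤP.∣-i∣≡∣i∣ (+ 2 * n)) (ℤP.abs-* (+ 2) n)) ⟩
    2 ℕ.* ∣ n ∣ ℕ.+ 1              ≡⟨ ℕP.+-comm (2 ℕ.* ∣ n ∣) 1 ⟩
    suc (∣ n ∣ ℕ.+ (∣ n ∣ ℕ.+ 0)) ≡⟨ cong (λ z → suc (∣ n ∣ ℕ.+ z)) (ℕP.+-identityʳ ∣ n ∣) ⟩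
    suc (∣ n ∣ ℕ.+ ∣ n ∣)          ∎
  where open ℕP.≤-Reasoning

reflect-vanishes : ∀ {g} B → SupportedIn² B g →
  ∀ m n → suc (B ℕ.+ B ℕ.+ B) < ∣ m ∣ → g (- m + ψ n) n ≡ 0ℤ
reflect-vanishes {g} B supp m n big with ∣ n ∣ ℕ.≤? B | ∣ - m + ψ n ∣ ℕ.≤? B
... | no n≰B | _      = supp _ n (inj₂ (ℕP.≰⇒> n≰B))
... | yes _  | no x≰B = supp _ n (inj₁ (ℕP.≰⇒> x≰B))
... | yes n≤B | yes x≤B = ⊥-elim (ℕP.<⇒≱ big ∣m∣≤)
  where
  x : ℤ
  x = - m + ψ n
  ∣m∣≤ : ∣ m ∣ ≤ suc (B ℕ.+ B ℕ.+ B)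
  ∣m∣≤ = begin
      ∣ m ∣                               ≡⟨ ℤP.∣-i∣≡∣i∣ m ⟨
      ∣ - m ∣                             ≡⟨ cong ∣_∣ (ring m (ψ n)) ⟩
      ∣ x - ψ n ∣                         ≤⟨ ℤP.∣i-j∣≤∣i∣+∣j∣ x (ψ n) ⟩
      ∣ x ∣ ℕ.+ ∣ ψ n ∣                   ≤⟨ ℕP.+-mono-≤ x≤B (ℕP.≤-trans (∣ψ∣≤ n) (s≤s (ℕP.+-mono-≤ n≤B n≤B))) ⟩
      B ℕ.+ suc (B ℕ.+ B)                 ≡⟨ ℕP.+-suc B (B ℕ.+ B) ⟩
      suc (B ℕ.+ (B ℕ.+ B))               ≡⟨ cong suc (ℕP.+-assoc B B B) ⟨
      suc (B ℕ.+ B ℕ.+ B)                 ∎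
    where
    open ℕP.≤-Reasoning
    ring : ∀ m c → - m ≡ - m + c - c
    ring = solve-∀

∑box²-reflect : ∀ {g} B M → SupportedIn² B g → suc (B ℕ.+ B ℕ.+ B) ≤ M →
  ∑box² M (λ m n → g (- m + ψ n) n) ≡ ∑box² M g
∑box²-reflect {g} B M supp le =
  trans (sym (∑box²-comm M (λ m n → g (- m + ψ n) n)))
        (trans (∑box-cong M column) (∑box²-comm M g))
  where
  column : ∀ n → ∑box M (λ m → g (- m + ψ n) n) ≡ ∑box M (λ r → g r n)
  column n with ∣ n ∣ ℕ.≤? B
  ... | yes n≤B =
    trans (∑box-neg M (λ i → g (i + ψ n) n))
    (trans (∑box-shift B M (ψ n) (λ r B<r → supp r n (inj₁ B<r)) shift≤M)
           (sym (∑box-resize B M (λ r B<r → supp r n (inj₁ B<r)) B≤M)))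
    where
    B≤M : B ≤ M
    B≤M = ℕP.≤-trans (ℕP.m≤n+m B (B ℕ.+ B)) (ℕP.≤-trans (ℕP.n≤1+n _) le)
    shift≤M : ∣ ψ n ∣ ℕ.+ B ≤ M
    shift≤M = ℕP.≤-trans (ℕP.+-monoˡ-≤ B (ℕP.≤-trans (∣ψ∣≤ n) (s≤s (ℕP.+-mono-≤ n≤B n≤B)))) le
  ... | no n≰B =
    trans (∑box-vanishing M (λ m → supp (- m + ψ n) n (inj₂ (ℕP.≰⇒> n≰B))))
          (sym (∑box-vanishing M (λ r → supp r n (inj₂ (ℕP.≰⇒> n≰B)))))

∑box²-even-odd : ∀ {G} B Q → (∀ m n → B < ∣ m ∣ → G m n ≡ 0ℤ) → B ≤ Q ℕ.+ Q →
  ∑box² (Q ℕ.+ Q) G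
    ≡ ∑box Q (λ s → ∑box (Q ℕ.+ Q) (G (+ 2 * s))) + ∑box Q (λ s → ∑box (Q ℕ.+ Q) (G (+ 2 * s + 1ℤ)))
∑box²-even-odd {G} B Q supp le =
  ∑box-even-odd B Q (λ m B<m → ∑box-vanishing (Q ℕ.+ Q) (λ n → supp m n B<m)) le

-- The summand of a Hecke-type double sum

δ : ℤ → ℤ → ℤ
δ x N = if ⌊ x ℤ.≟ N ⌋ then 1ℤ else 0ℤ

quadrantSign : ℤ → ℤ → ℤ
quadrantSign r s =
  if ⌊ 0ℤ ℤ.≤? r ⌋ ∧ ⌊ 0ℤ ℤ.≤? s ⌋ then 1ℤ
  else if ⌊ r ℤ.<? 0ℤ ⌋ ∧ ⌊ s ℤ.<? 0ℤ ⌋ then -1ℤ else 0ℤ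

-- σ ^ i; taking ∣ i ∣ is harmless because σ⁻¹ = σ.
signPow : Sign → ℤ → Sign
signPow σ i = sgnPow σ ∣ i ∣

sgnPow-+ : ∀ σ m n → sgnPow σ (m ℕ.+ n) ≡ sgnPow σ m Sign.* sgnPow σ n
sgnPow-+ σ zero    n = refl
sgnPow-+ σ (suc m) n = trans (cong (σ Sign.*_) (sgnPow-+ σ m n)) (sym (SignP.*-assoc σ _ _))

sgnPow-* : ∀ σ τ n → sgnPow (σ Sign.* τ) n ≡ sgnPow σ n Sign.* sgnPow τ n
sgnPow-* σ τ zero    = refl
sgnPow-* σ τ (suc n) = trans (cong (σ Sign.* τ Sign.*_) (sgnPow-* σ τ n)) (*-interchange σ τ _ _)

term≡δ*quadrantSign : ∀ a b c σx u σy v N r s →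
  term a b c σx u σy v N r s
    ≡ δ (halfExp a b c u v r s) N
      * (quadrantSign r s * sgnℤ (signPow (Sign.- Sign.* σx) r Sign.* signPow (Sign.- Sign.* σy) s))
term≡δ*quadrantSign a b c σx u σy v N r s =
  trans (if-factor ⌊ halfExp a b c u v r s ℤ.≟ N ⌋ _)
        (cong (δ (halfExp a b c u v r s) N *_)
          (trans (if-factor² (⌊ 0ℤ ℤ.≤? r ⌋ ∧ ⌊ 0ℤ ℤ.≤? s ⌋) (⌊ r ℤ.<? 0ℤ ⌋ ∧ ⌊ s ℤ.<? 0ℤ ⌋) _)
                 (cong (λ σ → quadrantSign r s * sgnℤ σ) termSign)))
  where
  if-factor : ∀ b x → (if b then x else 0ℤ) ≡ (if b then 1ℤ else 0ℤ) * x
  if-factor true  x = sym (ℤP.*-identityˡ x)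
  if-factor false x = refl
  if-factor² : ∀ b b′ x →
    (if b then x else if b′ then - x else 0ℤ) ≡ (if b then 1ℤ else if b′ then -1ℤ else 0ℤ) * x
  if-factor² true  b′    x = sym (ℤP.*-identityˡ x)
  if-factor² false true  x = sym (ℤP.-1*i≡-i x)
  if-factor² false false x = refl
  termSign : sgnPow Sign.- (∣ r ∣ ℕ.+ ∣ s ∣) Sign.* (sgnPow σx ∣ r ∣ Sign.* sgnPow σy ∣ s ∣)
           ≡ signPow (Sign.- Sign.* σx) r Sign.* signPow (Sign.- Sign.* σy) s
  termSign = begin
      sgnPow Sign.- (∣ r ∣ ℕ.+ ∣ s ∣) Sign.* (sgnPow σx ∣ r ∣ Sign.* sgnPow σy ∣ s ∣)
    ≡⟨ cong (Sign._* (sgnPow σx ∣ r ∣ Sign.* sgnPow σy ∣ s ∣)) (sgnPow-+ Sign.- ∣ r ∣ ∣ s ∣) ⟩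
      sgnPow Sign.- ∣ r ∣ Sign.* sgnPow Sign.- ∣ s ∣ Sign.* (sgnPow σx ∣ r ∣ Sign.* sgnPow σy ∣ s ∣)
    ≡⟨ *-interchange (sgnPow Sign.- ∣ r ∣) (sgnPow Sign.- ∣ s ∣) (sgnPow σx ∣ r ∣) (sgnPow σy ∣ s ∣) ⟩
      sgnPow Sign.- ∣ r ∣ Sign.* sgnPow σx ∣ r ∣ Sign.* (sgnPow Sign.- ∣ s ∣ Sign.* sgnPow σy ∣ s ∣)
    ≡⟨ cong₂ Sign._*_ (sgnPow-* Sign.- σx ∣ r ∣) (sgnPow-* Sign.- σy ∣ s ∣) ⟨
      signPow (Sign.- Sign.* σx) r Sign.* signPow (Sign.- Sign.* σy) s ∎
    where open ≡-Reasoning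

signPow-suc : ∀ σ i → signPow σ (i + 1ℤ) ≡ σ Sign.* signPow σ i
signPow-suc σ (+ n)          = cong (sgnPow σ) (ℕP.+-comm n 1)
signPow-suc Sign.- -[1+ 0 ]  = refl
signPow-suc Sign.+ -[1+ 0 ]  = refl
signPow-suc σ -[1+ suc n ]   =
  trans (cong (Sign._* sgnPow σ (suc n)) (sym (SignP.s*s≡+ σ))) (SignP.*-assoc σ σ _)

signPow-+-pos : ∀ σ i n → signPow σ (i + + n) ≡ signPow σ i Sign.* sgnPow σ n
signPow-+-pos σ i zero    = trans (cong (signPow σ) (ℤP.+-identityʳ i)) (sym (SignP.*-identityʳ _))
signPow-+-pos σ i (suc n) = begin
    signPow σ (i + + suc n)                  ≡⟨ cong (signPow σ) (ring i (+ n)) ⟩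
    signPow σ (i + + n + 1ℤ)                 ≡⟨ signPow-suc σ (i + + n) ⟩
    σ Sign.* signPow σ (i + + n)             ≡⟨ cong (σ Sign.*_) (signPow-+-pos σ i n) ⟩
    σ Sign.* (signPow σ i Sign.* sgnPow σ n) ≡⟨ SignP.*-assoc σ _ _ ⟨
    σ Sign.* signPow σ i Sign.* sgnPow σ n   ≡⟨ cong (Sign._* sgnPow σ n) (SignP.*-comm σ (signPow σ i)) ⟩
    signPow σ i Sign.* σ Sign.* sgnPow σ n   ≡⟨ SignP.*-assoc (signPow σ i) σ _ ⟩
    signPow σ i Sign.* sgnPow σ (suc n)      ∎
  where
  open ≡-Reasoning
  ring : ∀ i n → i + (1ℤ + n) ≡ i + n + 1ℤ
  ring = solve-∀

signPow-+ : ∀ σ i j → signPow σ (i + j) ≡ signPow σ i Sign.* signPow σ j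
signPow-+ σ i (+ n)      = signPow-+-pos σ i n
signPow-+ σ i -[1+ n ]   = begin
    signPow σ (i + j)                                 ≡⟨ SignP.*-identityʳ _ ⟨
    signPow σ (i + j) Sign.* Sign.+                   ≡⟨ cong (signPow σ (i + j) Sign.*_) (SignP.s*s≡+ (sgnPow σ (suc n))) ⟨
    signPow σ (i + j) Sign.* (τ Sign.* τ)             ≡⟨ SignP.*-assoc (signPow σ (i + j)) τ τ ⟨
    signPow σ (i + j) Sign.* τ Sign.* τ               ≡⟨ cong (Sign._* τ) (signPow-+-pos σ (i + j) (suc n)) ⟨
    signPow σ (i + j + + suc n) Sign.* τ              ≡⟨ cong (λ k → signPow σ k Sign.* τ) (ring i j) ⟩
    signPow σ i Sign.* τ                              ∎
  where
  open ≡-Reasoning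
  j : ℤ
  j = -[1+ n ]
  τ : Sign
  τ = sgnPow σ (suc n)
  ring : ∀ i j → i + j + - j ≡ i
  ring = solve-∀

signPow-even : ∀ σ s → signPow σ (+ 2 * s) ≡ Sign.+
signPow-even σ s =
  trans (cong (signPow σ) (ring s)) (trans (signPow-+ σ s s) (SignP.s*s≡+ (signPow σ s)))
  where
  ring : ∀ s → + 2 * s ≡ s + s
  ring = solve-∀

signPow-odd : ∀ σ s → signPow σ (+ 2 * s + 1ℤ) ≡ σ
signPow-odd σ s = trans (signPow-suc σ (+ 2 * s)) (trans (cong (σ Sign.*_) (signPow-even σ s)) (SignP.*-identityʳ σ))

isYes-true : ∀ {P : Set} (d : Dec P) → P → ⌊ d ⌋ ≡ true
isYes-true d p = trans (isYes≗does d) (dec-true d p)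

isYes-false : ∀ {P : Set} (d : Dec P) → ¬ P → ⌊ d ⌋ ≡ false
isYes-false d ¬p = trans (isYes≗does d) (dec-false d ¬p)

quadrantSign-pos-pos : ∀ {r s} → 0ℤ ℤ.≤ r → 0ℤ ℤ.≤ s → quadrantSign r s ≡ 1ℤ
quadrantSign-pos-pos {r} {s} r≥0 s≥0
  rewrite isYes-true (0ℤ ℤ.≤? r) r≥0 | isYes-true (0ℤ ℤ.≤? s) s≥0 = refl

quadrantSign-pos-neg : ∀ {r s} → 0ℤ ℤ.≤ r → ¬ 0ℤ ℤ.≤ s → quadrantSign r s ≡ 0ℤ
quadrantSign-pos-neg {r} {s} r≥0 s≱0
  rewrite isYes-true (0ℤ ℤ.≤? r) r≥0 | isYes-false (0ℤ ℤ.≤? s) s≱0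
        | isYes-false (r ℤ.<? 0ℤ) (ℤP.≤⇒≯ r≥0) = refl

quadrantSign-neg-pos : ∀ {r s} → ¬ 0ℤ ℤ.≤ r → 0ℤ ℤ.≤ s → quadrantSign r s ≡ 0ℤ
quadrantSign-neg-pos {r} {s} r≱0 s≥0
  rewrite isYes-false (0ℤ ℤ.≤? r) r≱0 | isYes-true (r ℤ.<? 0ℤ) (ℤP.≰⇒> r≱0)
        | isYes-false (s ℤ.<? 0ℤ) (ℤP.≤⇒≯ s≥0) = refl

quadrantSign-neg-neg : ∀ {r s} → ¬ 0ℤ ℤ.≤ r → ¬ 0ℤ ℤ.≤ s → quadrantSign r s ≡ -1ℤ
quadrantSign-neg-neg {r} {s} r≱0 s≱0
  rewrite isYes-false (0ℤ ℤ.≤? r) r≱0 | isYes-true (r ℤ.<? 0ℤ) (ℤP.≰⇒> r≱0)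
        | isYes-true (s ℤ.<? 0ℤ) (ℤP.≰⇒> s≱0) = refl

quadrantSign-reflect : ∀ m x s n →
  (0ℤ ℤ.≤ s → 0ℤ ℤ.≤ m) → (¬ 0ℤ ℤ.≤ s → ¬ 0ℤ ℤ.≤ m) →
  (0ℤ ℤ.≤ n + s → ¬ 0ℤ ℤ.≤ x) → (¬ 0ℤ ℤ.≤ n + s → 0ℤ ℤ.≤ x) →
  quadrantSign m n - quadrantSign x n ≡ quadrantSign (n + s) s
quadrantSign-reflect m x s n m⁺ m⁻ x⁻ x⁺ = cases (0ℤ ℤ.≤? s) (0ℤ ℤ.≤? n) (0ℤ ℤ.≤? (n + s))
  where
  cases : Dec (0ℤ ℤ.≤ s) → Dec (0ℤ ℤ.≤ n) → Dec (0ℤ ℤ.≤ n + s) →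
          quadrantSign m n - quadrantSign x n ≡ quadrantSign (n + s) s
  cases (yes s⁺) (yes n⁺) (yes y⁺)
    rewrite quadrantSign-pos-pos (m⁺ s⁺) n⁺ | quadrantSign-neg-pos (x⁻ y⁺) n⁺ | quadrantSign-pos-pos y⁺ s⁺ = refl
  cases (yes s⁺) (yes n⁺) (no y⁻) = ⊥-elim (y⁻ (ℤP.+-mono-≤ n⁺ s⁺))
  cases (yes s⁺) (no n⁻)  (yes y⁺)
    rewrite quadrantSign-pos-neg (m⁺ s⁺) n⁻ | quadrantSign-neg-neg (x⁻ y⁺) n⁻ | quadrantSign-pos-pos y⁺ s⁺ = refl
  cases (yes s⁺) (no n⁻)  (no y⁻)
    rewrite quadrantSign-pos-neg (m⁺ s⁺) n⁻ | quadrantSign-pos-neg (x⁺ y⁻) n⁻ | quadrantSign-neg-pos y⁻ s⁺ = refl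
  cases (no s⁻)  (yes n⁺) (yes y⁺)
    rewrite quadrantSign-neg-pos (m⁻ s⁻) n⁺ | quadrantSign-neg-pos (x⁻ y⁺) n⁺ | quadrantSign-pos-neg y⁺ s⁻ = refl
  cases (no s⁻)  (yes n⁺) (no y⁻)
    rewrite quadrantSign-neg-pos (m⁻ s⁻) n⁺ | quadrantSign-pos-pos (x⁺ y⁻) n⁺ | quadrantSign-neg-neg y⁻ s⁻ = refl
  cases (no s⁻)  (no n⁻)  (yes y⁺) = ⊥-elim (ℤP.<⇒≱ (ℤP.+-mono-< (ℤP.≰⇒> n⁻) (ℤP.≰⇒> s⁻)) y⁺)
  cases (no s⁻)  (no n⁻)  (no y⁻)
    rewrite quadrantSign-neg-neg (m⁻ s⁻) n⁻ | quadrantSign-pos-neg (x⁺ y⁻) n⁻ | quadrantSign-neg-neg y⁻ s⁻ = refl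

0≤-1-i : ∀ {i} → ¬ 0ℤ ℤ.≤ i → 0ℤ ℤ.≤ -1ℤ - i
0≤-1-i {+ k}      i≱0 = ⊥-elim (i≱0 (+≤+ z≤n))
0≤-1-i { -[1+ k ]} _   = +≤+ z≤n

i+j≡-1⇒¬0≤i : ∀ {i} j → 0ℤ ℤ.≤ j → i + j ≡ -1ℤ → ¬ 0ℤ ℤ.≤ i
i+j≡-1⇒¬0≤i j j≥0 eq i≥0 with subst (0ℤ ℤ.≤_) eq (ℤP.+-mono-≤ i≥0 j≥0)
... | ()

0≤i+i+j : ∀ {i} j → 0ℤ ℤ.≤ i → 0ℤ ℤ.≤ j → 0ℤ ℤ.≤ i + i + j
0≤i+i+j j i≥0 j≥0 = ℤP.+-mono-≤ (ℤP.+-mono-≤ i≥0 i≥0) j≥0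

quadrantSign-reflect-even : ∀ s n →
  quadrantSign (+ 2 * s) n - quadrantSign (- (+ 2 * s) + ψ n) n ≡ quadrantSign (n + s) s
quadrantSign-reflect-even s n = quadrantSign-reflect _ _ s n
  (λ s≥0 → subst (0ℤ ℤ.≤_) (ring₁ s) (0≤i+i+j 0ℤ s≥0 ℤP.≤-refl))
  (λ s≱0 → i+j≡-1⇒¬0≤i _ (0≤i+i+j 1ℤ (0≤-1-i s≱0) (+≤+ z≤n)) (ring₂ s))
  (λ y≥0 → i+j≡-1⇒¬0≤i _ (0≤i+i+j 0ℤ y≥0 ℤP.≤-refl) (ring₃ s n))
  (λ y≱0 → subst (0ℤ ℤ.≤_) (ring₄ s n) (0≤i+i+j 1ℤ (0≤-1-i y≱0) (+≤+ z≤n)))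
  where
  ring₁ : ∀ s → s + s + 0ℤ ≡ + 2 * s
  ring₁ = solve-∀
  ring₂ : ∀ s → + 2 * s + ((-1ℤ - s) + (-1ℤ - s) + 1ℤ) ≡ -1ℤ
  ring₂ = solve-∀
  ring₃ : ∀ s n → - (+ 2 * s) + (- (+ 2 * n) - 1ℤ) + ((n + s) + (n + s) + 0ℤ) ≡ -1ℤ
  ring₃ = solve-∀
  ring₄ : ∀ s n → (-1ℤ - (n + s)) + (-1ℤ - (n + s)) + 1ℤ ≡ - (+ 2 * s) + (- (+ 2 * n) - 1ℤ)
  ring₄ = solve-∀

quadrantSign-reflect-odd : ∀ s n →
  quadrantSign (+ 2 * s + 1ℤ) n - quadrantSign (- (+ 2 * s + 1ℤ) + ψ n) n ≡ quadrantSign (n + s) s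
quadrantSign-reflect-odd s n = quadrantSign-reflect _ _ s n
  (λ s≥0 → subst (0ℤ ℤ.≤_) (ring₁ s) (0≤i+i+j 1ℤ s≥0 (+≤+ z≤n)))
  (λ s≱0 → i+j≡-1⇒¬0≤i _ (0≤i+i+j 0ℤ (0≤-1-i s≱0) ℤP.≤-refl) (ring₂ s))
  (λ y≥0 → i+j≡-1⇒¬0≤i _ (0≤i+i+j 1ℤ y≥0 (+≤+ z≤n)) (ring₃ s n))
  (λ y≱0 → subst (0ℤ ℤ.≤_) (ring₄ s n) (0≤i+i+j 0ℤ (0≤-1-i y≱0) ℤP.≤-refl))
  where
  ring₁ : ∀ s → s + s + 1ℤ ≡ + 2 * s + 1ℤ
  ring₁ = solve-∀
  ring₂ : ∀ s → + 2 * s + 1ℤ + ((-1ℤ - s) + (-1ℤ - s) + 0ℤ) ≡ -1ℤ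
  ring₂ = solve-∀
  ring₃ : ∀ s n → - (+ 2 * s + 1ℤ) + (- (+ 2 * n) - 1ℤ) + ((n + s) + (n + s) + 1ℤ) ≡ -1ℤ
  ring₃ = solve-∀
  ring₄ : ∀ s n → (-1ℤ - (n + s)) + (-1ℤ - (n + s)) + 0ℤ ≡ - (+ 2 * s + 1ℤ) + (- (+ 2 * n) - 1ℤ)
  ring₄ = solve-∀

δ-cong-⇔ : ∀ {x N y M} → (x ≡ N → y ≡ M) → (y ≡ M → x ≡ N) → δ x N ≡ δ y M
δ-cong-⇔ {x} {N} {y} {M} to from with x ℤ.≟ N
... | yes x≡N rewrite isYes-true (y ℤ.≟ M) (to x≡N) = refl
... | no  x≢N rewrite isYes-false (y ℤ.≟ M) (x≢N ∘ from) = refl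

δ-shift : ∀ x N c → δ x (N - c) ≡ δ (x + c) N
δ-shift x N c =
  δ-cong-⇔ (λ x≡ → trans (cong (_+ c) x≡) (ring₁ N c)) (λ ≡N → trans (ring₂ x c) (cong (_- c) ≡N))
  where
  ring₁ : ∀ N c → N - c + c ≡ N
  ring₁ = solve-∀
  ring₂ : ∀ x c → x ≡ x + c - c
  ring₂ = solve-∀

term-at : ∀ a b c σx u σy v N r s {E z} →
  halfExp a b c u v r s ≡ E →
  sgnℤ (signPow (Sign.- Sign.* σx) r Sign.* signPow (Sign.- Sign.* σy) s) ≡ z →
  term a b c σx u σy v N r s ≡ δ E N * (quadrantSign r s * z)
term-at a b c σx u σy v N r s refl refl = term≡δ*quadrantSign a b c σx u σy v N r s

term-shifted-at : ∀ a b c σx u σy v N c′ r s {E z} →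
  halfExp a b c u v r s + c′ ≡ E →
  sgnℤ (signPow (Sign.- Sign.* σx) r Sign.* signPow (Sign.- Sign.* σy) s) ≡ z →
  term a b c σx u σy v (N - c′) r s ≡ δ E N * (quadrantSign r s * z)
term-shifted-at a b c σx u σy v N c′ r s refl refl =
  trans (term≡δ*quadrantSign a b c σx u σy v (N - c′) r s)
        (cong (_* _) (δ-shift (halfExp a b c u v r s) N c′))

halfExp-expand : ∀ a b c u v r s {A B C U} → + a ≡ A → + (2 ℕ.* b) ≡ B → + c ≡ C → u ≡ U →
  halfExp a b c u v r s ≡ A * r * (r - 1ℤ) + B * r * s + C * s * (s - 1ℤ) + U * r + v * s
halfExp-expand a b c u v r s refl refl refl refl = refl

sgnℤ-* : ∀ σ τ → sgnℤ (σ Sign.* τ) ≡ sgnℤ σ * sgnℤ τ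
sgnℤ-* Sign.+ Sign.+ = refl
sgnℤ-* Sign.+ Sign.- = refl
sgnℤ-* Sign.- Sign.+ = refl
sgnℤ-* Sign.- Sign.- = refl

sgnℤ*sgnℤ : ∀ σ → sgnℤ σ * sgnℤ σ ≡ 1ℤ
sgnℤ*sgnℤ Sign.+ = refl
sgnℤ*sgnℤ Sign.- = refl

sign-cancel : ∀ e → e * e ≡ 1ℤ → ∀ t a b p →
  t * (a * p) + (- e) * (t * (b * (e * p))) ≡ t * ((a - b) * p)
sign-cancel e e²≡1 t a b p = begin
    t * (a * p) + (- e) * (t * (b * (e * p))) ≡⟨ ring₁ e t a b p ⟩
    t * (a * p) - (e * e) * (t * (b * p))     ≡⟨ cong (λ z → t * (a * p) - z * (t * (b * p))) e²≡1 ⟩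
    t * (a * p) - 1ℤ * (t * (b * p))          ≡⟨ ring₂ t a b p ⟩
    t * ((a - b) * p)                         ∎
  where
  open ≡-Reasoning
  ring₁ : ∀ e t a b p → t * (a * p) + (- e) * (t * (b * (e * p))) ≡ t * (a * p) - (e * e) * (t * (b * p))
  ring₁ = solve-∀
  ring₂ : ∀ t a b p → t * (a * p) - 1ℤ * (t * (b * p)) ≡ t * ((a - b) * p)
  ring₂ = solve-∀

sign-factor : ∀ e t a b p → t * (a * (e * p)) + (- e) * (t * (b * p)) ≡ e * (t * ((a - b) * p))
sign-factor = solve-∀

signPow-lhs : ∀ s n → sgnℤ (signPow Sign.- (n + s) Sign.* signPow Sign.- s) ≡ sgnℤ (signPow Sign.- n)
signPow-lhs s n = cong sgnℤ (begin
    signPow Sign.- (n + s) Sign.* signPow Sign.- s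
  ≡⟨ cong (Sign._* signPow Sign.- s) (signPow-+ Sign.- n s) ⟩
    signPow Sign.- n Sign.* signPow Sign.- s Sign.* signPow Sign.- s
  ≡⟨ SignP.*-assoc (signPow Sign.- n) _ _ ⟩
    signPow Sign.- n Sign.* (signPow Sign.- s Sign.* signPow Sign.- s)
  ≡⟨ cong (signPow Sign.- n Sign.*_) (SignP.s*s≡+ (signPow Sign.- s)) ⟩
    signPow Sign.- n Sign.* Sign.+
  ≡⟨ SignP.*-identityʳ (signPow Sign.- n) ⟩
    signPow Sign.- n ∎)
  where open ≡-Reasoning

signPow-rhs-even : ∀ ε i t n → i ≡ + 2 * t →
  sgnℤ (signPow (Sign.- Sign.* Sign.opposite ε) i Sign.* signPow Sign.- n) ≡ sgnℤ (signPow Sign.- n)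
signPow-rhs-even ε i t n refl = cong (λ σ → sgnℤ (σ Sign.* signPow Sign.- n)) (signPow-even _ t)

signPow-rhs-odd : ∀ ε i t n → i ≡ + 2 * t + 1ℤ →
  sgnℤ (signPow (Sign.- Sign.* Sign.opposite ε) i Sign.* signPow Sign.- n) ≡ sgnℤ ε * sgnℤ (signPow Sign.- n)
signPow-rhs-odd ε i t n refl =
  trans (cong (λ σ → sgnℤ (σ Sign.* signPow Sign.- n)) (trans (signPow-odd _ t) (SignP.opposite-involutive ε)))
        (sgnℤ-* ε (signPow Sign.- n))

-- Bounding the support

squareBound : ℕ → ℕ → ℕ → ℕ
squareBound n U V = n ℕ.+ U ℕ.+ V ℕ.+ U ℕ.* U ℕ.+ V ℕ.* V

*≤sq+sq : ∀ y V → V ℕ.* y ≤ y ℕ.* y ℕ.+ V ℕ.* V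
*≤sq+sq y V with ℕP.≤-total y V
... | inj₁ y≤V = ℕP.≤-trans (ℕP.*-monoʳ-≤ V y≤V) (ℕP.m≤n+m (V ℕ.* V) (y ℕ.* y))
... | inj₂ V≤y = ℕP.≤-trans (ℕP.*-monoˡ-≤ y V≤y) (ℕP.m≤m+n (y ℕ.* y) (V ℕ.* V))

sq≤lin⇒≤ : ∀ x U X → x ℕ.* x ≤ X ℕ.+ U ℕ.* x → x ≤ U ℕ.+ X
sq≤lin⇒≤ x U X sq≤ with x ℕ.≤? U ℕ.+ X
... | yes x≤ = x≤
... | no x≰  = ⊥-elim (ℕP.<⇒≱ (lin<sq x (ℕP.≰⇒> x≰)) sq≤)
  where
  lin<sq : ∀ x → suc (U ℕ.+ X) ≤ x → X ℕ.+ U ℕ.* x < x ℕ.* x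
  lin<sq (suc x) big =
    ℕP.≤-trans (ℕP.≤-trans (ℕP.m≤m+n _ (x ℕ.* X ℕ.+ x)) (ℕP.≤-reflexive (ring x U X)))
               (ℕP.*-monoʳ-≤ (suc x) big)
    where
    ring : ∀ x U X → suc (X ℕ.+ U ℕ.* suc x) ℕ.+ (x ℕ.* X ℕ.+ x) ≡ suc x ℕ.* suc (U ℕ.+ X)
    ring = ℕ-Solver.solve-∀

sumsq≤lin⇒≤ : ∀ x y n U V → x ℕ.* x ℕ.+ y ℕ.* y ≤ n ℕ.+ U ℕ.* x ℕ.+ V ℕ.* y →
  x ≤ U ℕ.+ (n ℕ.+ V ℕ.* V)
sumsq≤lin⇒≤ x y n U V sq≤ =
  sq≤lin⇒≤ x U (n ℕ.+ V ℕ.* V) (ℕP.+-cancelʳ-≤ (y ℕ.* y) (x ℕ.* x) (n ℕ.+ V ℕ.* V ℕ.+ U ℕ.* x) sq≤′)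
  where
  ring : ∀ n U V x y → n ℕ.+ U ℕ.* x ℕ.+ (y ℕ.* y ℕ.+ V ℕ.* V) ≡ n ℕ.+ V ℕ.* V ℕ.+ U ℕ.* x ℕ.+ y ℕ.* y
  ring = ℕ-Solver.solve-∀
  sq≤′ : x ℕ.* x ℕ.+ y ℕ.* y ≤ n ℕ.+ V ℕ.* V ℕ.+ U ℕ.* x ℕ.+ y ℕ.* y
  sq≤′ = ℕP.≤-trans sq≤ (ℕP.≤-trans (ℕP.+-monoʳ-≤ (n ℕ.+ U ℕ.* x) (*≤sq+sq y V))
                                    (ℕP.≤-reflexive (ring n U V x y)))

sumsq≤lin⇒bounded : ∀ x y n U V → x ℕ.* x ℕ.+ y ℕ.* y ≤ n ℕ.+ U ℕ.* x ℕ.+ V ℕ.* y →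
  x ≤ squareBound n U V × y ≤ squareBound n U V
sumsq≤lin⇒bounded x y n U V sq≤ =
  ℕP.≤-trans (sumsq≤lin⇒≤ x y n U V sq≤)
             (ℕP.≤-trans (ℕP.m≤m+n _ (V ℕ.+ U ℕ.* U)) (ℕP.≤-reflexive (ring₁ n U V))) ,
  ℕP.≤-trans (sumsq≤lin⇒≤ y x n V U sq≤′)
             (ℕP.≤-trans (ℕP.m≤m+n _ (U ℕ.+ V ℕ.* V)) (ℕP.≤-reflexive (ring₂ n U V)))
  where
  ring₁ : ∀ n U V → U ℕ.+ (n ℕ.+ V ℕ.* V) ℕ.+ (V ℕ.+ U ℕ.* U) ≡ n ℕ.+ U ℕ.+ V ℕ.+ U ℕ.* U ℕ.+ V ℕ.* V
  ring₁ = ℕ-Solver.solve-∀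
  ring₂ : ∀ n U V → V ℕ.+ (n ℕ.+ U ℕ.* U) ℕ.+ (U ℕ.+ V ℕ.* V) ≡ n ℕ.+ U ℕ.+ V ℕ.+ U ℕ.* U ℕ.+ V ℕ.* V
  ring₂ = ℕ-Solver.solve-∀
  ring₃ : ∀ x y n U V → n ℕ.+ U ℕ.* x ℕ.+ V ℕ.* y ≡ n ℕ.+ V ℕ.* y ℕ.+ U ℕ.* x
  ring₃ = ℕ-Solver.solve-∀
  sq≤′ : y ℕ.* y ℕ.+ x ℕ.* x ≤ n ℕ.+ V ℕ.* y ℕ.+ U ℕ.* x
  sq≤′ = subst₂ _≤_ (ℕP.+-comm (x ℕ.* x) (y ℕ.* y)) (ring₃ x y n U V) sq≤

0≤i*j : ∀ {i j} → 0ℤ ℤ.≤ i → 0ℤ ℤ.≤ j → 0ℤ ℤ.≤ i * j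
0≤i*j {+ m} {+ n} _ _ = subst (0ℤ ℤ.≤_) (ℤP.pos-* m n) (+≤+ z≤n)

0≤i*[i-1] : ∀ i → 0ℤ ℤ.≤ i * (i - 1ℤ)
0≤i*[i-1] (+ zero)  = +≤+ z≤n
0≤i*[i-1] (+ suc k) = 0≤i*j {+ suc k} {+ k} (+≤+ z≤n) (+≤+ z≤n)
0≤i*[i-1] -[1+ k ]  = +≤+ z≤n

i*i≡∣i∣*∣i∣ : ∀ i → i * i ≡ + (∣ i ∣ ℕ.* ∣ i ∣)
i*i≡∣i∣*∣i∣ i = trans (sym (ℤP.0≤i⇒+∣i∣≡i (i*i≥0 i))) (cong +_ (ℤP.abs-* i i))
  where
  i*i≥0 : ∀ i → 0ℤ ℤ.≤ i * i
  i*i≥0 (+ m)    = 0≤i*j {+ m} {+ m} (+≤+ z≤n) (+≤+ z≤n)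
  i*i≥0 -[1+ m ] = +≤+ z≤n

supportBound : ℤ → ℤ → ℤ → ℕ
supportBound u v N = squareBound (∣ N ∣) (∣ u - 1ℤ ∣) (∣ v - 1ℤ ∣)

-- With a, c ≥ 1 and r s ≥ 0 the quadratic part of the exponent is at least
-- r² - r + s² - s, so r² + s² ≤ ∣N∣ + ∣u - 1∣ ∣r∣ + ∣v - 1∣ ∣s∣.
exponent-bound : ∀ a b c u v N r s → halfExp (suc a) b (suc c) u v r s ≡ N → 0ℤ ℤ.≤ r * s →
  ∣ r ∣ ≤ supportBound u v N × ∣ s ∣ ≤ supportBound u v N
exponent-bound a b c u v N r s exp≡N rs≥0 =
  sumsq≤lin⇒bounded (∣ r ∣) (∣ s ∣) (∣ N ∣) (∣ u - 1ℤ ∣) (∣ v - 1ℤ ∣) (ℤP.drop‿+≤+ sumsq≤lin)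
  where
  w₁ : ℤ
  w₁ = (u - 1ℤ) * r
  w₂ : ℤ
  w₂ = (v - 1ℤ) * s
  slack : ℤ
  slack = (+ ∣ N ∣ - N) + + a * (r * (r - 1ℤ)) + + (2 ℕ.* b) * (r * s) + + c * (s * (s - 1ℤ))
          + (+ ∣ w₁ ∣ + w₁) + (+ ∣ w₂ ∣ + w₂)
  slack≥0 : 0ℤ ℤ.≤ slack
  slack≥0 = ℤP.+-mono-≤ (ℤP.+-mono-≤ (ℤP.+-mono-≤ (ℤP.+-mono-≤ (ℤP.+-mono-≤ (0≤∣i∣-i N)
              (0≤i*j {+ a} (+≤+ z≤n) (0≤i*[i-1] r))) (0≤i*j {+ (2 ℕ.* b)} (+≤+ z≤n) rs≥0))
              (0≤i*j {+ c} (+≤+ z≤n) (0≤i*[i-1] s))) (0≤∣i∣+i w₁)) (0≤∣i∣+i w₂)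
  ring : ∀ n a b c u v r s w₁ w₂ →
    n + w₁ + w₂ ≡ r * r + s * s + ((n - ((1ℤ + a) * r * (r - 1ℤ) + b * r * s + (1ℤ + c) * s * (s - 1ℤ) + u * r + v * s))
      + a * (r * (r - 1ℤ)) + b * (r * s) + c * (s * (s - 1ℤ)) + (w₁ + (u - 1ℤ) * r) + (w₂ + (v - 1ℤ) * s))
  ring = solve-∀
  decompose : + ∣ N ∣ + + ∣ w₁ ∣ + + ∣ w₂ ∣ ≡ r * r + s * s + slack
  decompose = trans (ring (+ ∣ N ∣) (+ a) (+ (2 ℕ.* b)) (+ c) u v r s (+ ∣ w₁ ∣) (+ ∣ w₂ ∣))
    (cong (λ z → r * r + s * s + ((+ ∣ N ∣ - z) + + a * (r * (r - 1ℤ)) + + (2 ℕ.* b) * (r * s)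
                 + + c * (s * (s - 1ℤ)) + (+ ∣ w₁ ∣ + w₁) + (+ ∣ w₂ ∣ + w₂))) exp≡N)
  sumsq≤lin : + (∣ r ∣ ℕ.* ∣ r ∣ ℕ.+ ∣ s ∣ ℕ.* ∣ s ∣)
              ℤ.≤ + (∣ N ∣ ℕ.+ ∣ u - 1ℤ ∣ ℕ.* ∣ r ∣ ℕ.+ ∣ v - 1ℤ ∣ ℕ.* ∣ s ∣)
  sumsq≤lin = subst₂ ℤ._≤_ (cong₂ _+_ (i*i≡∣i∣*∣i∣ r) (i*i≡∣i∣*∣i∣ s))
    (cong₂ (λ p q → + ∣ N ∣ + + p + + q) (ℤP.abs-* (u - 1ℤ) r) (ℤP.abs-* (v - 1ℤ) s))
    (subst (r * r + s * s ℤ.≤_) (sym decompose)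
      (subst (ℤ._≤ r * r + s * s + slack) (ℤP.+-identityʳ _) (ℤP.+-monoʳ-≤ (r * r + s * s) slack≥0)))

term-supported : ∀ a b c σx u σy v N →
  SupportedIn² (supportBound u v N) (term (suc a) b (suc c) σx u σy v N)
term-supported a b c σx u σy v N r s outside =
  trans (term≡δ*quadrantSign (suc a) b (suc c) σx u σy v N r s)
        (vanish (E ℤ.≟ N) (0ℤ ℤ.≤? r) (0ℤ ℤ.≤? s))
  where
  E : ℤ
  E = halfExp (suc a) b (suc c) u v r s
  σ : ℤ
  σ = sgnℤ (signPow (Sign.- Sign.* σx) r Sign.* signPow (Sign.- Sign.* σy) s)
  inside : E ≡ N → ¬ 0ℤ ℤ.≤ r * s
  inside E≡N rs≥0 = contradict outside (exponent-bound a b c u v N r s E≡N rs≥0)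
    where
    contradict : ∀ {B} → B < ∣ r ∣ ⊎ B < ∣ s ∣ → ∣ r ∣ ≤ B × ∣ s ∣ ≤ B → ⊥
    contradict (inj₁ B<r) (r≤ , _) = ℕP.<⇒≱ B<r r≤
    contradict (inj₂ B<s) (_ , s≤) = ℕP.<⇒≱ B<s s≤
  neg*neg : ∀ {i j} → ¬ 0ℤ ℤ.≤ i → ¬ 0ℤ ℤ.≤ j → 0ℤ ℤ.≤ i * j
  neg*neg {+ _}      {_}        i≱0 _   = ⊥-elim (i≱0 (+≤+ z≤n))
  neg*neg { -[1+ _ ]} {+ _}      _   j≱0 = ⊥-elim (j≱0 (+≤+ z≤n))
  neg*neg { -[1+ _ ]} { -[1+ _ ]} _   _   = +≤+ z≤n
  vanish : Dec (E ≡ N) → Dec (0ℤ ℤ.≤ r) → Dec (0ℤ ℤ.≤ s) → δ E N * (quadrantSign r s * σ) ≡ 0ℤ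
  vanish (no E≢N) _ _ rewrite isYes-false (E ℤ.≟ N) E≢N = refl
  vanish (yes E≡N) (yes r⁺) (yes s⁺) = ⊥-elim (inside E≡N (0≤i*j r⁺ s⁺))
  vanish (yes _)   (yes r⁺) (no s⁻) rewrite quadrantSign-pos-neg r⁺ s⁻ = ℤP.*-zeroʳ (δ E N)
  vanish (yes _)   (no r⁻)  (yes s⁺) rewrite quadrantSign-neg-pos r⁻ s⁺ = ℤP.*-zeroʳ (δ E N)
  vanish (yes E≡N) (no r⁻)  (no s⁻) = ⊥-elim (inside E≡N (neg*neg r⁻ s⁻))

-- The four series of the proposition

module Series (K : ℕ) (d e : ℤ) (ε : Sign) (N : ℤ) where

  k ε̂ shift₁ shift₂ : ℤ
  k = + K
  ε̂ = sgnℤ ε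
  shift₁ = + K + d + e
  shift₂ = + K + + 2 - d - e

  lhsExp₁ lhsExp₂ rhsExp₁ rhsExp₂ : ℤ → ℤ → ℤ
  lhsExp₁ = halfExp 1 (suc (2 ℕ.* K)) 1 (+ 2 * d) (+ 2 * e)
  lhsExp₂ = halfExp 1 (suc (2 ℕ.* K)) 1 (+ 2 * (1ℤ + + K + d)) (+ 2 * (1ℤ + + K + e))
  rhsExp₁ = halfExp (suc K) (suc K) 1 (+ K + d + e) (+ 2 * d)
  rhsExp₂ = halfExp (suc K) (suc K) 1 (+ 4 + + (3 ℕ.* K) - d - e) (+ 2 * (+ K + + 2 - e))

  lhs₁ lhs₂ rhs₁ rhs₂ : ℤ → ℤ → ℤ
  lhs₁ = term 1 (suc (2 ℕ.* K)) 1 Sign.+ (+ 2 * d) Sign.+ (+ 2 * e) N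
  lhs₂ = term 1 (suc (2 ℕ.* K)) 1 Sign.+ (+ 2 * (1ℤ + + K + d)) Sign.+ (+ 2 * (1ℤ + + K + e)) (N - shift₁)
  rhs₁ = term (suc K) (suc K) 1 (Sign.opposite ε) (+ K + d + e) Sign.+ (+ 2 * d) N
  rhs₂ = term (suc K) (suc K) 1 (Sign.opposite ε) (+ 4 + + (3 ℕ.* K) - d - e) Sign.+ (+ 2 * (+ K + + 2 - e))
              (N - shift₂)

  lhsCoeff≡ : ∀ M → lhsCoeff K d e ε M N ≡ ∑box² M lhs₁ + ε̂ * ∑box² M lhs₂
  lhsCoeff≡ M = cong₂ (λ a b → a + ε̂ * b)
    (fCoeff≡∑box² 1 (suc (2 ℕ.* K)) 1 Sign.+ (+ 2 * d) Sign.+ (+ 2 * e) M N)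
    (fCoeff≡∑box² 1 (suc (2 ℕ.* K)) 1 Sign.+ (+ 2 * (1ℤ + + K + d)) Sign.+ (+ 2 * (1ℤ + + K + e)) M (N - shift₁))

  rhsCoeff≡ : ∀ M → rhsCoeff K d e ε M N ≡ ∑box² M rhs₁ - ε̂ * ∑box² M rhs₂
  rhsCoeff≡ M = cong₂ (λ a b → a - ε̂ * b)
    (fCoeff≡∑box² (suc K) (suc K) 1 (Sign.opposite ε) (+ K + d + e) Sign.+ (+ 2 * d) M N)
    (fCoeff≡∑box² (suc K) (suc K) 1 (Sign.opposite ε) (+ 4 + + (3 ℕ.* K) - d - e) Sign.+ (+ 2 * (+ K + + 2 - e))
                  M (N - shift₂))

  lhs-cast : + (2 ℕ.* suc (2 ℕ.* K)) ≡ + 2 * (1ℤ + + 2 * k)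
  lhs-cast = trans (ℤP.pos-* 2 (suc (2 ℕ.* K))) (cong (λ z → + 2 * (1ℤ + z)) (ℤP.pos-* 2 K))

  rhs-cast : + (2 ℕ.* suc K) ≡ + 2 * (1ℤ + k)
  rhs-cast = ℤP.pos-* 2 (suc K)

  rhs₂-cast : + 4 + + (3 ℕ.* K) - d - e ≡ + 4 + + 3 * k - d - e
  rhs₂-cast = cong (λ z → + 4 + z - d - e) (ℤP.pos-* 3 K)

  lhs-expand : ∀ u v r s → halfExp 1 (suc (2 ℕ.* K)) 1 u v r s
    ≡ 1ℤ * r * (r - 1ℤ) + + 2 * (1ℤ + + 2 * k) * r * s + 1ℤ * s * (s - 1ℤ) + u * r + v * s
  lhs-expand u v r s = halfExp-expand 1 (suc (2 ℕ.* K)) 1 u v r s refl lhs-cast refl refl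

  rhs-expand : ∀ u {U} v r s → u ≡ U → halfExp (suc K) (suc K) 1 u v r s
    ≡ (1ℤ + k) * r * (r - 1ℤ) + + 2 * (1ℤ + k) * r * s + 1ℤ * s * (s - 1ℤ) + U * r + v * s
  rhs-expand u v r s u≡U = halfExp-expand (suc K) (suc K) 1 u v r s refl rhs-cast refl u≡U

  exponent-even : ∀ s n → rhsExp₁ (+ 2 * s) n ≡ lhsExp₁ (n + s) s
  exponent-even s n =
    trans (rhs-expand (+ K + d + e) (+ 2 * d) (+ 2 * s) n refl)
    (trans (ring k d e s n)
           (sym (lhs-expand (+ 2 * d) (+ 2 * e) (n + s) s)))
    where
    ring : ∀ k d e s n →
        (1ℤ + k) * (+ 2 * s) * (+ 2 * s - 1ℤ) + + 2 * (1ℤ + k) * (+ 2 * s) * n + 1ℤ * n * (n - 1ℤ)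
          + (k + d + e) * (+ 2 * s) + + 2 * d * n
      ≡ 1ℤ * (n + s) * (n + s - 1ℤ) + + 2 * (1ℤ + + 2 * k) * (n + s) * s + 1ℤ * s * (s - 1ℤ)
          + + 2 * d * (n + s) + + 2 * e * s
    ring = solve-∀

  exponent-even-reflected : ∀ s n → rhsExp₂ (- (+ 2 * s) + ψ n) n + shift₂ ≡ lhsExp₁ (n + s) s
  exponent-even-reflected s n =
    trans (cong (_+ shift₂) (rhs-expand (+ 4 + + (3 ℕ.* K) - d - e) (+ 2 * (+ K + + 2 - e)) (- (+ 2 * s) + ψ n) n rhs₂-cast))
    (trans (ring k d e s n)
           (sym (lhs-expand (+ 2 * d) (+ 2 * e) (n + s) s)))
    where
    ring : ∀ k d e s n →
        (1ℤ + k) * (- (+ 2 * s) + (- (+ 2 * n) - 1ℤ)) * ((- (+ 2 * s) + (- (+ 2 * n) - 1ℤ)) - 1ℤ)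
          + + 2 * (1ℤ + k) * (- (+ 2 * s) + (- (+ 2 * n) - 1ℤ)) * n + 1ℤ * n * (n - 1ℤ)
          + (+ 4 + + 3 * k - d - e) * (- (+ 2 * s) + (- (+ 2 * n) - 1ℤ)) + + 2 * (k + + 2 - e) * n
          + (k + + 2 - d - e)
      ≡ 1ℤ * (n + s) * (n + s - 1ℤ) + + 2 * (1ℤ + + 2 * k) * (n + s) * s + 1ℤ * s * (s - 1ℤ)
          + + 2 * d * (n + s) + + 2 * e * s
    ring = solve-∀

  exponent-odd : ∀ s n → rhsExp₁ (+ 2 * s + 1ℤ) n ≡ lhsExp₂ (n + s) s + shift₁
  exponent-odd s n =
    trans (rhs-expand (+ K + d + e) (+ 2 * d) (+ 2 * s + 1ℤ) n refl)
    (trans (ring k d e s n)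
           (sym (cong (_+ shift₁) (lhs-expand (+ 2 * (1ℤ + + K + d)) (+ 2 * (1ℤ + + K + e)) (n + s) s))))
    where
    ring : ∀ k d e s n →
        (1ℤ + k) * (+ 2 * s + 1ℤ) * (+ 2 * s + 1ℤ - 1ℤ) + + 2 * (1ℤ + k) * (+ 2 * s + 1ℤ) * n
          + 1ℤ * n * (n - 1ℤ) + (k + d + e) * (+ 2 * s + 1ℤ) + + 2 * d * n
      ≡ 1ℤ * (n + s) * (n + s - 1ℤ) + + 2 * (1ℤ + + 2 * k) * (n + s) * s + 1ℤ * s * (s - 1ℤ)
          + + 2 * (1ℤ + k + d) * (n + s) + + 2 * (1ℤ + k + e) * s + (k + d + e)
    ring = solve-∀

  exponent-odd-reflected : ∀ s n → rhsExp₂ (- (+ 2 * s + 1ℤ) + ψ n) n + shift₂ ≡ lhsExp₂ (n + s) s + shift₁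
  exponent-odd-reflected s n =
    trans (cong (_+ shift₂) (rhs-expand (+ 4 + + (3 ℕ.* K) - d - e) (+ 2 * (+ K + + 2 - e)) (- (+ 2 * s + 1ℤ) + ψ n) n rhs₂-cast))
    (trans (ring k d e s n)
           (sym (cong (_+ shift₁) (lhs-expand (+ 2 * (1ℤ + + K + d)) (+ 2 * (1ℤ + + K + e)) (n + s) s))))
    where
    ring : ∀ k d e s n →
        (1ℤ + k) * (- (+ 2 * s + 1ℤ) + (- (+ 2 * n) - 1ℤ)) * ((- (+ 2 * s + 1ℤ) + (- (+ 2 * n) - 1ℤ)) - 1ℤ)
          + + 2 * (1ℤ + k) * (- (+ 2 * s + 1ℤ) + (- (+ 2 * n) - 1ℤ)) * n + 1ℤ * n * (n - 1ℤ)
          + (+ 4 + + 3 * k - d - e) * (- (+ 2 * s + 1ℤ) + (- (+ 2 * n) - 1ℤ)) + + 2 * (k + + 2 - e) * n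
          + (k + + 2 - d - e)
      ≡ 1ℤ * (n + s) * (n + s - 1ℤ) + + 2 * (1ℤ + + 2 * k) * (n + s) * s + 1ℤ * s * (s - 1ℤ)
          + + 2 * (1ℤ + k + d) * (n + s) + + 2 * (1ℤ + k + e) * s + (k + d + e)
    ring = solve-∀

  lhs₁-at : ∀ r s {E z} → lhsExp₁ r s ≡ E → sgnℤ (signPow Sign.- r Sign.* signPow Sign.- s) ≡ z →
    lhs₁ r s ≡ δ E N * (quadrantSign r s * z)
  lhs₁-at = term-at 1 (suc (2 ℕ.* K)) 1 Sign.+ (+ 2 * d) Sign.+ (+ 2 * e) N

  lhs₂-at : ∀ r s {E z} → lhsExp₂ r s + shift₁ ≡ E → sgnℤ (signPow Sign.- r Sign.* signPow Sign.- s) ≡ z →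
    lhs₂ r s ≡ δ E N * (quadrantSign r s * z)
  lhs₂-at = term-shifted-at 1 (suc (2 ℕ.* K)) 1 Sign.+ (+ 2 * (1ℤ + + K + d)) Sign.+ (+ 2 * (1ℤ + + K + e)) N shift₁

  rhs₁-at : ∀ m n {E z} → rhsExp₁ m n ≡ E →
    sgnℤ (signPow (Sign.- Sign.* Sign.opposite ε) m Sign.* signPow Sign.- n) ≡ z →
    rhs₁ m n ≡ δ E N * (quadrantSign m n * z)
  rhs₁-at = term-at (suc K) (suc K) 1 (Sign.opposite ε) (+ K + d + e) Sign.+ (+ 2 * d) N

  rhs₂-at : ∀ m n {E z} → rhsExp₂ m n + shift₂ ≡ E →
    sgnℤ (signPow (Sign.- Sign.* Sign.opposite ε) m Sign.* signPow Sign.- n) ≡ z →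
    rhs₂ m n ≡ δ E N * (quadrantSign m n * z)
  rhs₂-at = term-shifted-at (suc K) (suc K) 1 (Sign.opposite ε) (+ 4 + + (3 ℕ.* K) - d - e) Sign.+ (+ 2 * (+ K + + 2 - e))
              N shift₂

  combined : ℤ → ℤ → ℤ
  combined m n = rhs₁ m n + (- ε̂) * rhs₂ (- m + ψ n) n

  combined-even : ∀ s n → combined (+ 2 * s) n ≡ lhs₁ (n + s) s
  combined-even s n = begin
      rhs₁ m n + (- ε̂) * rhs₂ x n
    ≡⟨ cong₂ (λ a b → a + (- ε̂) * b)
         (rhs₁-at m n (exponent-even s n) (signPow-rhs-even ε m s n refl))
         (rhs₂-at x n (exponent-even-reflected s n) (signPow-rhs-odd ε x (-1ℤ - s - n) n (ring s n))) ⟩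
      δ E N * (quadrantSign m n * p) + (- ε̂) * (δ E N * (quadrantSign x n * (ε̂ * p)))
    ≡⟨ sign-cancel ε̂ (sgnℤ*sgnℤ ε) (δ E N) (quadrantSign m n) (quadrantSign x n) p ⟩
      δ E N * ((quadrantSign m n - quadrantSign x n) * p)
    ≡⟨ cong (λ q → δ E N * (q * p)) (quadrantSign-reflect-even s n) ⟩
      δ E N * (quadrantSign (n + s) s * p)
    ≡⟨ lhs₁-at (n + s) s refl (signPow-lhs s n) ⟨
      lhs₁ (n + s) s ∎
    where
    open ≡-Reasoning
    m : ℤ
    m = + 2 * s
    x : ℤ
    x = - m + ψ n
    E : ℤ
    E = lhsExp₁ (n + s) s
    p : ℤ
    p = sgnℤ (signPow Sign.- n)
    ring : ∀ s n → - (+ 2 * s) + (- (+ 2 * n) - 1ℤ) ≡ + 2 * (-1ℤ - s - n) + 1ℤ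
    ring = solve-∀

  combined-odd : ∀ s n → combined (+ 2 * s + 1ℤ) n ≡ ε̂ * lhs₂ (n + s) s
  combined-odd s n = begin
      rhs₁ m n + (- ε̂) * rhs₂ x n
    ≡⟨ cong₂ (λ a b → a + (- ε̂) * b)
         (rhs₁-at m n (exponent-odd s n) (signPow-rhs-odd ε m s n refl))
         (rhs₂-at x n (exponent-odd-reflected s n) (signPow-rhs-even ε x (-1ℤ - s - n) n (ring s n))) ⟩
      δ E N * (quadrantSign m n * (ε̂ * p)) + (- ε̂) * (δ E N * (quadrantSign x n * p))
    ≡⟨ sign-factor ε̂ (δ E N) (quadrantSign m n) (quadrantSign x n) p ⟩
      ε̂ * (δ E N * ((quadrantSign m n - quadrantSign x n) * p))
    ≡⟨ cong (λ q → ε̂ * (δ E N * (q * p))) (quadrantSign-reflect-odd s n) ⟩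
      ε̂ * (δ E N * (quadrantSign (n + s) s * p))
    ≡⟨ cong (ε̂ *_) (lhs₂-at (n + s) s refl (signPow-lhs s n)) ⟨
      ε̂ * lhs₂ (n + s) s ∎
    where
    open ≡-Reasoning
    m : ℤ
    m = + 2 * s + 1ℤ
    x : ℤ
    x = - m + ψ n
    E : ℤ
    E = lhsExp₂ (n + s) s + shift₁
    p : ℤ
    p = sgnℤ (signPow Sign.- n)
    ring : ∀ s n → - (+ 2 * s + 1ℤ) + (- (+ 2 * n) - 1ℤ) ≡ + 2 * (-1ℤ - s - n)
    ring = solve-∀

  B₁ B₂ B₃ B₄ Bc Q W : ℕ
  B₁ = supportBound (+ 2 * d) (+ 2 * e) N
  B₂ = supportBound (+ 2 * (1ℤ + + K + d)) (+ 2 * (1ℤ + + K + e)) (N - shift₁)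
  B₃ = supportBound (+ K + d + e) (+ 2 * d) N
  B₄ = supportBound (+ 4 + + (3 ℕ.* K) - d - e) (+ 2 * (+ K + + 2 - e)) (N - shift₂)
  Bc = B₃ ℕ.+ suc (B₄ ℕ.+ B₄ ℕ.+ B₄)
  Q = B₁ ℕ.+ B₂ ℕ.+ Bc
  W = Q ℕ.+ Q

  lhs₁-supported : SupportedIn² B₁ lhs₁
  lhs₁-supported = term-supported 0 (suc (2 ℕ.* K)) 0 Sign.+ (+ 2 * d) Sign.+ (+ 2 * e) N

  lhs₂-supported : SupportedIn² B₂ lhs₂
  lhs₂-supported =
    term-supported 0 (suc (2 ℕ.* K)) 0 Sign.+ (+ 2 * (1ℤ + + K + d)) Sign.+ (+ 2 * (1ℤ + + K + e)) (N - shift₁)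

  rhs₁-supported : SupportedIn² B₃ rhs₁
  rhs₁-supported = term-supported K (suc K) 0 (Sign.opposite ε) (+ K + d + e) Sign.+ (+ 2 * d) N

  rhs₂-supported : SupportedIn² B₄ rhs₂
  rhs₂-supported = term-supported K (suc K) 0 (Sign.opposite ε) (+ 4 + + (3 ℕ.* K) - d - e) Sign.+
                     (+ 2 * (+ K + + 2 - e)) (N - shift₂)

  ε̂lhs₂-supported : SupportedIn² B₂ (λ r s → ε̂ * lhs₂ r s)
  ε̂lhs₂-supported r s outside = trans (cong (ε̂ *_) (lhs₂-supported r s outside)) (ℤP.*-zeroʳ ε̂)

  combined-supported : ∀ m n → Bc < ∣ m ∣ → combined m n ≡ 0ℤ
  combined-supported m n Bc<m =
    trans (cong₂ (λ a b → a + (- ε̂) * b)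
                 (rhs₁-supported m n (inj₁ (ℕP.≤-<-trans (ℕP.m≤m+n B₃ _) Bc<m)))
                 (reflect-vanishes B₄ rhs₂-supported m n (ℕP.≤-<-trans (ℕP.m≤n+m _ B₃) Bc<m)))
          (trans (ℤP.+-identityˡ _) (ℤP.*-zeroʳ (- ε̂)))

  Q≤W : Q ≤ W
  Q≤W = ℕP.m≤m+n Q Q

  B₁≤Q : B₁ ≤ Q
  B₁≤Q = ℕP.≤-trans (ℕP.m≤m+n B₁ B₂) (ℕP.m≤m+n _ Bc)

  B₂≤Q : B₂ ≤ Q
  B₂≤Q = ℕP.≤-trans (ℕP.m≤n+m B₂ B₁) (ℕP.m≤m+n _ Bc)

  Bc≤Q : Bc ≤ Q
  Bc≤Q = ℕP.m≤n+m Bc (B₁ ℕ.+ B₂)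

  B₃≤Q : B₃ ≤ Q
  B₃≤Q = ℕP.≤-trans (ℕP.m≤m+n B₃ _) Bc≤Q

  3B₄<Q : B₄ ℕ.+ B₄ ℕ.+ B₄ < Q
  3B₄<Q = ℕP.≤-trans (ℕP.m≤n+m _ B₃) Bc≤Q

  B₄≤Q : B₄ ≤ Q
  B₄≤Q = ℕP.≤-trans (ℕP.≤-trans (ℕP.m≤n+m B₄ (B₄ ℕ.+ B₄)) (ℕP.n≤1+n _)) 3B₄<Q

  identity-at-W : ∑box² W rhs₁ - ε̂ * ∑box² W rhs₂ ≡ ∑box² W lhs₁ + ε̂ * ∑box² W lhs₂
  identity-at-W = begin
      ∑box² W rhs₁ - ε̂ * ∑box² W rhs₂
    ≡⟨ cong (_+_ (∑box² W rhs₁)) (ℤP.neg-distribˡ-* ε̂ _) ⟩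
      ∑box² W rhs₁ + (- ε̂) * ∑box² W rhs₂
    ≡⟨ cong (λ z → ∑box² W rhs₁ + (- ε̂) * z)
            (∑box²-reflect B₄ W rhs₂-supported (ℕP.≤-trans 3B₄<Q Q≤W)) ⟨
      ∑box² W rhs₁ + (- ε̂) * ∑box² W (λ m n → rhs₂ (- m + ψ n) n)
    ≡⟨ cong (_+_ (∑box² W rhs₁)) (*-distribˡ-∑box² W (- ε̂) (λ m n → rhs₂ (- m + ψ n) n)) ⟩
      ∑box² W rhs₁ + ∑box² W (λ m n → (- ε̂) * rhs₂ (- m + ψ n) n)
    ≡⟨ ∑box²-distrib-+ W rhs₁ (λ m n → (- ε̂) * rhs₂ (- m + ψ n) n) ⟨
      ∑box² W combined
    ≡⟨ ∑box²-even-odd Bc Q combined-supported (ℕP.≤-trans Bc≤Q Q≤W) ⟩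
      ∑box Q (λ s → ∑box W (combined (+ 2 * s))) + ∑box Q (λ s → ∑box W (combined (+ 2 * s + 1ℤ)))
    ≡⟨ cong₂ _+_ (∑box-cong Q (λ s → ∑box-cong W (combined-even s)))
                 (∑box-cong Q (λ s → ∑box-cong W (combined-odd s))) ⟩
      ∑box Q (λ s → ∑box W (λ n → lhs₁ (n + s) s)) + ∑box Q (λ s → ∑box W (λ n → ε̂ * lhs₂ (n + s) s))
    ≡⟨ cong₂ _+_ (∑box-sheared-rows B₁ Q W lhs₁-supported B₁≤Q Q≤W (ℕP.+-mono-≤ B₁≤Q B₁≤Q))
                 (∑box-sheared-rows B₂ Q W ε̂lhs₂-supported B₂≤Q Q≤W (ℕP.+-mono-≤ B₂≤Q B₂≤Q)) ⟩
      ∑box² W lhs₁ + ∑box² W (λ r s → ε̂ * lhs₂ r s)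
    ≡⟨ cong (_+_ (∑box² W lhs₁)) (*-distribˡ-∑box² W ε̂ lhs₂) ⟨
      ∑box² W lhs₁ + ε̂ * ∑box² W lhs₂ ∎
    where open ≡-Reasoning

proposition5p1 : (K : ℕ) → 1 ≤ K → (d e : ℤ) → (ε : Sign) →
    (N : ℤ) → ∃[ M₀ ] ((M : ℕ) → M₀ ≤ M → lhsCoeff K d e ε M N ≡ rhsCoeff K d e ε M N)
proposition5p1 K _ d e ε N = W , coefficients-agree
  where
  open Series K d e ε N
  open ≡-Reasoning
  coefficients-agree : ∀ M → W ≤ M → lhsCoeff K d e ε M N ≡ rhsCoeff K d e ε M N
  coefficients-agree M W≤M = begin
      lhsCoeff K d e ε M N
    ≡⟨ lhsCoeff≡ M ⟩
      ∑box² M lhs₁ + ε̂ * ∑box² M lhs₂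
    ≡⟨ cong₂ (λ a b → a + ε̂ * b) (∑box²-stable B₁ W M lhs₁-supported (ℕP.≤-trans B₁≤Q Q≤W) W≤M)
                                  (∑box²-stable B₂ W M lhs₂-supported (ℕP.≤-trans B₂≤Q Q≤W) W≤M) ⟩
      ∑box² W lhs₁ + ε̂ * ∑box² W lhs₂
    ≡⟨ identity-at-W ⟨
      ∑box² W rhs₁ - ε̂ * ∑box² W rhs₂
    ≡⟨ cong₂ (λ a b → a - ε̂ * b) (∑box²-stable B₃ W M rhs₁-supported (ℕP.≤-trans B₃≤Q Q≤W) W≤M)
                                  (∑box²-stable B₄ W M rhs₂-supported (ℕP.≤-trans B₄≤Q Q≤W) W≤M) ⟨
      ∑box² M rhs₁ - ε̂ * ∑box² M rhs₂
    ≡⟨ rhsCoeff≡ M ⟨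
      rhsCoeff K d e ε M N ∎
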